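{- For $p\in\{213,231,312\}$, all $k\ge0$ and all $n\ge1$, $f_p(k,1,n)=g_p(k,n-1)$.
   Context: $\mathcal S_n$ is the set of permutations of $[n]$; $\mathcal S_0$ contains only the empty permutation. The standard cycle form writes each cycle starting with its smallest element, cycles listed in decreasing order of smallest elements; $\Psi(\pi)$ is the word obtained by deleting the parentheses. A cyclic occurrence of the consecutive pattern $p\in\mathcal S_3$ in $\pi$ is a position $i$ such that $\Psi(\pi)_i,\Psi(\pi)_{i+1},\Psi(\pi)_{i+2}$ lie in the same cycle and are order-isomorphic to $p$. $f_p(k,m,n)$ is the number of $\pi\in\mathcal S_n$ with $m$ cycles and exactly $k$ cyclic occurrences of $p$. $g_p(k,n)$ is the number of $\pi\in\mathcal S_n$ having exactly $k$ indices $i$ with $\pi(i)\pi(i+1)\pi(i+2)$ (one-line notation) order-isomorphic to $p$. -}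

module Defs where

open import Data.Nat using (ℕ; zero; suc; _<ᵇ_; _≤ᵇ_; _≡ᵇ_)
open import Data.Bool using (Bool; true; false; _∧_; not; if_then_else_)
open import Data.List using (List; []; _∷_; [_]; map; concatMap; allFin; takeWhileᵇ; filterᵇ; length; reverse)
open import Data.Vec as V using (Vec; lookup; toList)
open import Data.Fin using (Fin; toℕ)
open import Data.Product using (_×_; _,_)
open import Data.Bool.ListAction using (all; any)

-- Permutations of [n] = {0,…,n-1} (0-based; order-isomorphism is unaffected)
-- in one-line notation: v with π(i) = lookup v i.

allVecs : (m n : ℕ) → List (Vec (Fin n) m)
allVecs zero    n = [ V.[] ]
allVecs (suc m) n = concatMap (λ i → map (i V.∷_) (allVecs m n)) (allFin n)

_==F_ : ∀ {n} → Fin n → Fin n → Bool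
a ==F b = toℕ a ≡ᵇ toℕ b

-- v is a permutation iff every j ∈ [n] occurs in v (surjective ⇔ bijective on a finite set)
isPerm : ∀ {n} → Vec (Fin n) n → Bool
isPerm {n} v = all (λ j → any (λ x → x ==F j) (toList v)) (allFin n)

iter : ∀ {n} → Vec (Fin n) n → ℕ → Fin n → List (Fin n)
iter v zero    x = []
iter v (suc k) x = x ∷ iter v k (lookup v x)

cycleFrom : ∀ {n} → Vec (Fin n) n → Fin n → List (Fin n)
cycleFrom {n} v a = a ∷ takeWhileᵇ (λ x → not (x ==F a)) (iter v n (lookup v a))

isCycleMin : ∀ {n} → Vec (Fin n) n → Fin n → Bool
isCycleMin v a = all (λ x → toℕ a ≤ᵇ toℕ x) (cycleFrom v a)

cycleMins : ∀ {n} → Vec (Fin n) n → List (Fin n)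
cycleMins {n} v = reverse (filterᵇ (isCycleMin v) (allFin n))

numCycles : ∀ {n} → Vec (Fin n) n → ℕ
numCycles v = length (cycleMins v)

-- Ψ(π) for the standard cycle form, each letter tagged with (the minimum of) its cycle:
-- entries are (letter , cycle label)
psiLabelled : ∀ {n} → Vec (Fin n) n → List (ℕ × ℕ)
psiLabelled v = concatMap (λ a → map (λ x → (toℕ x , toℕ a)) (cycleFrom v a)) (cycleMins v)

windows3 : ∀ {A : Set} → List A → List (A × A × A)
windows3 (a ∷ b ∷ c ∷ rest) = (a , b , c) ∷ windows3 (b ∷ c ∷ rest)
windows3 _ = []

-- patterns of length 3 are given as triples, e.g. 213 as (2 , 1 , 3)
Pattern : Set
Pattern = ℕ × ℕ × ℕ

orderIso : ℕ × ℕ × ℕ → Pattern → Bool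
orderIso (a , b , c) (x , y , z) =
  ((a <ᵇ b) ≡ᵇB (x <ᵇ y)) ∧ (((a <ᵇ c) ≡ᵇB (x <ᵇ z)) ∧ ((b <ᵇ c) ≡ᵇB (y <ᵇ z)))
  where
  _≡ᵇB_ : Bool → Bool → Bool
  true  ≡ᵇB b = b
  false ≡ᵇB b = not b

countᵇ : ∀ {A : Set} → (A → Bool) → List A → ℕ
countᵇ P xs = length (filterᵇ P xs)

cycOcc : ∀ {n} → Pattern → Vec (Fin n) n → ℕ
cycOcc p v = countᵇ (λ { ((x , i) , (y , j) , (z , k)) →
                          ((i ≡ᵇ j) ∧ (j ≡ᵇ k)) ∧ orderIso (x , y , z) p })
                    (windows3 (psiLabelled v))

lineOcc : ∀ {n} → Pattern → Vec (Fin n) n → ℕ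
lineOcc p v = countᵇ (λ t → orderIso t p) (windows3 (map toℕ (toList v)))

f : Pattern → ℕ → ℕ → ℕ → ℕ
f p k m n = countᵇ (λ v → isPerm v ∧ ((numCycles v ≡ᵇ m) ∧ (cycOcc p v ≡ᵇ k))) (allVecs n n)

g : Pattern → ℕ → ℕ → ℕ
g p k n = countᵇ (λ v → isPerm v ∧ (lineOcc p v ≡ᵇ k)) (allVecs n n)

-- A permutation π of {0,…,m} with a single cycle has standard cycle form (0 π(0) π²(0) … π^m(0)),
-- so Ψ(π) = 0 c₁ … c_m with c_i = π^i(0).  Its first window (0, c₁, c₂) begins with its smallest
-- letter, hence is an occurrence of none of 213, 231, 312; all other windows are the windows of
-- c₁ … c_m.  Lowering every letter by one, π ↦ (c₁−1, …, c_m−1) is a bijection from the cyclic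
-- permutations of {0,…,m} onto the permutations of {0,…,m−1} in one-line notation, and it
-- preserves the patterns of these windows.  One cycle is recognised through the cycle minima:
-- if no nonzero letter is the minimum of its cycle, every letter descends to 0 along π, so the
-- orbit of 0 is everything.

module Submission where

open import Defs
open import Data.Bool using (Bool; true; false; T; not; _∧_)
open import Data.Bool.Properties using (T-∧; T-≡)
open import Data.Empty using (⊥-elim)
open import Data.Fin as Fin using (Fin; zero; suc; toℕ; fromℕ<; punchOut)
open import Data.Fin.Induction using (<-wellFounded)
open import Data.Fin.Properties using (pigeonhole; punchOut-injective; toℕ-injective; toℕ<n; toℕ-fromℕ<; suc-injective; any?; _≟_; opposite-prop; fromℕ<-toℕ; 0≢1+n)
open import Data.List as List using (List; []; _∷_; map; filterᵇ; length; tabulate; allFin; reverse; takeWhileᵇ)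
open import Data.List.Membership.Propositional using (_∈_; lose; find)
open import Data.List.Membership.Propositional.Properties using (∈-map⁺; ∈-map⁻; ∈-concat⁺′; ∈-allFin; ∈-filter⁺; ∈-filter⁻; ∈-tabulate⁺)
open import Data.List.Membership.Propositional.Properties.WithK using (unique∧set⇒bag)
open import Data.List.Relation.Binary.BagAndSetEquality using (∼bag⇒↭)
open import Data.List.Relation.Binary.Permutation.Propositional.Properties using (↭-length)
open import Data.List.Relation.Unary.All as All using ([]; _∷_)
import Data.List.Relation.Unary.All.Properties as All
open import Data.List.Relation.Unary.Any using (here; there)
import Data.List.Relation.Unary.Any.Properties as Any
open import Data.List.Relation.Unary.AllPairs as AllPairs using ([]; _∷_)
import Data.List.Relation.Unary.AllPairs.Properties as AllPairs
open import Data.List.Relation.Binary.Disjoint.Propositional using (Disjoint)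
open import Data.List.Relation.Unary.Unique.Propositional using (Unique)
import Data.List.Relation.Unary.Unique.Propositional.Properties as Unique
open import Data.List.Properties using (length-map; ++-identityʳ; map-tabulate; tabulate-cong; length-reverse; filter-accept; filter-reject; filter-none; filter-some)
import Data.List.Relation.Binary.Sublist.Propositional as Sublist
open import Data.List.Relation.Binary.Sublist.Propositional.Properties using (takeWhile-⊆)
open import Data.List.Relation.Unary.All.Properties.Core using (¬All⇒Any¬)
open import Data.Nat as ℕ using (ℕ; zero; suc; _+_; _*_; _∸_; _<_; _≤_; _≡ᵇ_; s≤s; z≤n; s≤s⁻¹; NonZero; >-nonZero)
open import Data.Nat.Properties
  using (n<1+n; ≡ᵇ⇒≡; ≡⇒≡ᵇ; <-irrefl; <⇒≢; <⇒≤; ≤-trans; +-comm; *-suc; m∸n≤m; m<n⇒0<n∸m; m∸n+n≡m; m+[n∸m]≡n; m≤n⇒m<n∨m≡n; <-≤-trans; ≤-refl; ≤⇒≤ᵇ; ≰⇒>; +-∸-assoc)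
  renaming (suc-injective to ℕ-suc-injective)
open import Data.Nat.DivMod using (_%_; _/_; m≡m%n+[m/n]*n; m%n<n)
open import Data.Nat.GeneralisedArithmetic using (iterate)
open import Data.Product using (∃; _×_; _,_; proj₁; proj₂)
open import Data.Sum using (_⊎_; inj₁; inj₂)
open import Data.Vec as Vec using (Vec; lookup; toList)
open import Data.Vec.Properties using (lookup∘tabulate; tabulate∘lookup)
import Data.Vec.Properties as Vec
open import Data.Vec.Membership.Propositional.Properties using (∈-lookup; ∈-toList⁺)
import Data.Vec.Relation.Unary.Any as VecAny
import Data.Vec.Relation.Unary.Any.Properties as VecAny
open import Function using (_∘_; _⇔_; mk⇔; Equivalence)
open import Induction.WellFounded using (Acc; acc)
open import Function.Definitions using (Injective; StrictlySurjective)
open import Relation.Binary.PropositionalEquality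
open ≡-Reasoning
open import Relation.Nullary using (¬_; yes; no)
open import Relation.Nullary.Decidable using (T?)

Unique-map⁺-on : ∀ {A B : Set} {f : A → B} {xs : List A} →
  (∀ {x y} → x ∈ xs → y ∈ xs → f x ≡ f y → x ≡ y) → Unique xs → Unique (map f xs)
Unique-map⁺-on inj [] = []
Unique-map⁺-on inj (x∉xs ∷ u) =
  All.map⁺ (All.tabulate λ y∈xs fx≡fy → All.lookup x∉xs y∈xs (inj (here refl) (there y∈xs) fx≡fy))
  ∷ Unique-map⁺-on (λ x∈ y∈ → inj (there x∈) (there y∈)) u

countᵇ-bijection : ∀ {A B : Set} {xs : List A} {ys : List B} →
  Unique xs → Unique ys → (∀ a → a ∈ xs) → (∀ b → b ∈ ys) →
  (P : A → Bool) (Q : B → Bool) (φ : A → B) →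
  (∀ a → T (P a) → T (Q (φ a))) →
  (∀ a a′ → T (P a) → T (P a′) → φ a ≡ φ a′ → a ≡ a′) →
  (∀ b → T (Q b) → ∃ λ a → T (P a) × φ a ≡ b) →
  countᵇ P xs ≡ countᵇ Q ys
countᵇ-bijection {xs = xs} {ys} xs-unique ys-unique xs-all ys-all P Q φ maps inj onto =
  trans (sym (length-map φ (filterᵇ P xs)))
        (↭-length (∼bag⇒↭ (unique∧set⇒bag image-unique (Unique.filter⁺ (T? ∘ Q) ys-unique) (mk⇔ to from))))
  where
  P-of : ∀ {a} → a ∈ filterᵇ P xs → T (P a)
  P-of = proj₂ ∘ ∈-filter⁻ (T? ∘ P) {xs = xs}
  Q-of : ∀ {b} → b ∈ filterᵇ Q ys → T (Q b)
  Q-of = proj₂ ∘ ∈-filter⁻ (T? ∘ Q) {xs = ys}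
  image-unique : Unique (map φ (filterᵇ P xs))
  image-unique = Unique-map⁺-on (λ a∈ a′∈ → inj _ _ (P-of a∈) (P-of a′∈)) (Unique.filter⁺ (T? ∘ P) xs-unique)
  to : ∀ {b} → b ∈ map φ (filterᵇ P xs) → b ∈ filterᵇ Q ys
  to b∈ with a , a∈ , refl ← ∈-map⁻ φ b∈ = ∈-filter⁺ (T? ∘ Q) (ys-all _) (maps a (P-of a∈))
  from : ∀ {b} → b ∈ filterᵇ Q ys → b ∈ map φ (filterᵇ P xs)
  from {b} b∈ with a , Pa , refl ← onto b (Q-of b∈) = ∈-map⁺ φ (∈-filter⁺ (T? ∘ P) (xs-all a) Pa)

countᵇ-map-cong : ∀ {A B : Set} {C : B → Bool} {D : A → Bool} (f : A → B) →
  (∀ x → C (f x) ≡ D x) → ∀ xs → countᵇ C (map f xs) ≡ countᵇ D xs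
countᵇ-map-cong f same [] = refl
countᵇ-map-cong {C = C} {D} f same (x ∷ xs) with C (f x) | D x | same x
... | true  | .true  | refl = cong suc (countᵇ-map-cong f same xs)
... | false | .false | refl = countᵇ-map-cong f same xs

map₃ : ∀ {A B : Set} → (A → B) → A × A × A → B × B × B
map₃ f (x , y , z) = f x , f y , f z

windows3-map : ∀ {A B : Set} (f : A → B) xs → windows3 (map f xs) ≡ map (map₃ f) (windows3 xs)
windows3-map f []                 = refl
windows3-map f (x ∷ [])           = refl
windows3-map f (x ∷ y ∷ [])       = refl
windows3-map f (x ∷ y ∷ z ∷ rest) = cong (_ ∷_) (windows3-map f (y ∷ z ∷ rest))

countᵇ-windows3-∷-map : ∀ {A : Set} {C : A × A × A → Bool} {D : ℕ × ℕ × ℕ → Bool} {x₀ : A} {f : ℕ → A} →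
  (∀ a b c → C (f a , f b , f c) ≡ D (a , b , c)) → (∀ a b → C (x₀ , f a , f b) ≡ false) →
  ∀ zs → countᵇ C (windows3 (x₀ ∷ map f zs)) ≡ countᵇ D (windows3 zs)
countᵇ-windows3-∷-map same first []           = refl
countᵇ-windows3-∷-map same first (a ∷ [])     = refl
countᵇ-windows3-∷-map {C = C} {f = f} same first (a ∷ b ∷ rest) = begin
  countᵇ C (windows3 (_ ∷ map f (a ∷ b ∷ rest)))  ≡⟨ cong length (filter-reject (T? ∘ C) (subst T (first a b))) ⟩
  countᵇ C (windows3 (map f (a ∷ b ∷ rest)))      ≡⟨ cong (countᵇ C) (windows3-map f (a ∷ b ∷ rest)) ⟩
  countᵇ C (map (map₃ f) (windows3 (a ∷ b ∷ rest))) ≡⟨ countᵇ-map-cong {C = C} (map₃ f) (λ { (x , y , z) → same x y z }) (windows3 (a ∷ b ∷ rest)) ⟩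
  countᵇ _ (windows3 (a ∷ b ∷ rest))              ∎

∈-allVecs : ∀ m n (v : Vec (Fin n) m) → v ∈ allVecs m n
∈-allVecs zero    n Vec.[]       = here refl
∈-allVecs (suc m) n (i Vec.∷ v) =
  ∈-concat⁺′ (∈-map⁺ (i Vec.∷_) (∈-allVecs m n v)) (∈-map⁺ (λ j → map (j Vec.∷_) (allVecs m n)) (∈-allFin i))

allVecs-unique : ∀ m n → Unique (allVecs m n)
allVecs-unique zero    n = [] ∷ []
allVecs-unique (suc m) n =
  Unique.concat⁺ (All.map⁺ (All.tabulate λ _ → Unique.map⁺ ∷-injectiveʳ (allVecs-unique m n)))
                 (AllPairs.map⁺ (AllPairs.map heads-differ (Unique.allFin⁺ n)))
  where
  ∷-injectiveʳ : ∀ {i} {u w : Vec (Fin n) m} → i Vec.∷ u ≡ i Vec.∷ w → u ≡ w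
  ∷-injectiveʳ refl = refl
  heads-differ : ∀ {i j} → i ≢ j → Disjoint (map (i Vec.∷_) (allVecs m n)) (map (j Vec.∷_) (allVecs m n))
  heads-differ i≢j (v∈ , v∈′) with _ , _ , refl ← ∈-map⁻ _ v∈ | _ , _ , refl ← ∈-map⁻ _ v∈′ = i≢j refl

injective⇒surjective : ∀ {n} (f : Fin n → Fin n) → Injective _≡_ _≡_ f → StrictlySurjective _≡_ f
injective⇒surjective f inj y with any? (λ x → f x ≟ y)
... | yes hit = hit
injective⇒surjective {suc n} f inj y | no miss
  with i , j , i<j , same ← pigeonhole (n<1+n n) (λ x → punchOut {i = y} (miss ∘ (x ,_) ∘ sym))
  = ⊥-elim (<-irrefl (cong toℕ (inj (punchOut-injective {i = y} _ _ same))) i<j)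

surjective⇒injective : ∀ {n} (f : Fin n → Fin n) → StrictlySurjective _≡_ f → Injective _≡_ _≡_ f
surjective⇒injective f surj {a} {b} fa≡fb =
  both-sections (section-surjective a) (section-surjective b)
  where
  section = proj₁ ∘ surj
  section-surjective : StrictlySurjective _≡_ section
  section-surjective = injective⇒surjective section λ {x} {y} eq →
    trans (sym (proj₂ (surj x))) (trans (cong f eq) (proj₂ (surj y)))
  both-sections : (∃ λ c → section c ≡ a) → (∃ λ d → section d ≡ b) → a ≡ b
  both-sections (c , refl) (d , refl) = cong section (trans (sym (proj₂ (surj c))) (trans fa≡fb (proj₂ (surj d))))

injective-below : ∀ {A : Set} {n} (f : ℕ → A) → Injective _≡_ _≡_ (f ∘ toℕ {n}) →
  ∀ {j k} → j < n → k < n → f j ≡ f k → j ≡ k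
injective-below f inj {j} {k} j<n k<n fj≡fk = begin
  j                 ≡⟨ toℕ-fromℕ< j<n ⟨
  toℕ (fromℕ< j<n)  ≡⟨ cong toℕ (inj (begin
    f (toℕ (fromℕ< j<n))  ≡⟨ cong f (toℕ-fromℕ< j<n) ⟩
    f j                   ≡⟨ fj≡fk ⟩
    f k                   ≡⟨ cong f (toℕ-fromℕ< k<n) ⟨
    f (toℕ (fromℕ< k<n))  ∎)) ⟩
  toℕ (fromℕ< k<n)  ≡⟨ toℕ-fromℕ< k<n ⟩
  k                 ∎

module _ {A : Set} (f : A → A) where

  iterate-+ : ∀ x j k → iterate f x (j + k) ≡ iterate f (iterate f x j) k
  iterate-+ x zero    k = refl
  iterate-+ x (suc j) k = iterate-+ (f x) j k

  iterate-suc : ∀ x k → iterate f x (suc k) ≡ f (iterate f x k)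
  iterate-suc x zero    = refl
  iterate-suc x (suc k) = iterate-suc (f x) k

  iterate-comm : ∀ x j k → iterate f (iterate f x j) k ≡ iterate f (iterate f x k) j
  iterate-comm x j k = begin
    iterate f (iterate f x j) k  ≡⟨ iterate-+ x j k ⟨
    iterate f x (j + k)          ≡⟨ cong (iterate f x) (+-comm j k) ⟩
    iterate f x (k + j)          ≡⟨ iterate-+ x k j ⟩
    iterate f (iterate f x k) j  ∎

  iterate-* : ∀ {x d} → iterate f x d ≡ x → ∀ j → iterate f x (j * d) ≡ x
  iterate-* fixed zero = refl
  iterate-* {x} {d} fixed (suc j) = begin
    iterate f x (d + j * d)            ≡⟨ iterate-+ x d (j * d) ⟩
    iterate f (iterate f x d) (j * d)  ≡⟨ cong (λ y → iterate f y (j * d)) fixed ⟩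
    iterate f x (j * d)                ≡⟨ iterate-* fixed j ⟩
    x                                  ∎

iterate-cong : ∀ {A : Set} {f g : A → A} → (∀ x → f x ≡ g x) → ∀ x k → iterate f x k ≡ iterate g x k
iterate-cong f≗g x zero    = refl
iterate-cong f≗g x (suc k) = trans (cong (λ y → iterate _ y k) (f≗g x)) (iterate-cong f≗g _ k)

module _ {n} {π : Fin n → Fin n} (π-injective : Injective _≡_ _≡_ π) where

  iterate-injective : ∀ k → Injective _≡_ _≡_ (λ x → iterate π x k)
  iterate-injective zero    eq = eq
  iterate-injective (suc k) eq = π-injective (iterate-injective k eq)

  period : ∀ x → ∃ λ d → 0 < d × d ≤ n × iterate π x d ≡ x
  period x = from-collision (pigeonhole (n<1+n n) (iterate π x ∘ toℕ))
    where
    from-collision : (∃ λ i → ∃ λ j → i Fin.< j × iterate π x (toℕ i) ≡ iterate π x (toℕ j)) →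
                     ∃ λ d → 0 < d × d ≤ n × iterate π x d ≡ x
    from-collision (i , j , i<j , same) =
      toℕ j ∸ toℕ i , m<n⇒0<n∸m i<j , ≤-trans (m∸n≤m (toℕ j) (toℕ i)) (s≤s⁻¹ (toℕ<n j)) ,
      iterate-injective (toℕ i) (begin
        iterate π (iterate π x (toℕ j ∸ toℕ i)) (toℕ i)  ≡⟨ iterate-+ π x (toℕ j ∸ toℕ i) (toℕ i) ⟨
        iterate π x (toℕ j ∸ toℕ i + toℕ i)             ≡⟨ cong (iterate π x) (m∸n+n≡m (<⇒≤ i<j)) ⟩
        iterate π x (toℕ j)                             ≡⟨ same ⟨
        iterate π x (toℕ i)                             ∎)

  iterate-returns : ∀ x j → ∃ λ i → iterate π (iterate π x j) i ≡ x
  iterate-returns x j with period x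
  ... | suc d , _ , _ , fixed = j * d , (begin
    iterate π (iterate π x j) (j * d)  ≡⟨ iterate-+ π x j (j * d) ⟨
    iterate π x (j + j * d)            ≡⟨ cong (iterate π x) (*-suc j d) ⟨
    iterate π x (j * suc d)            ≡⟨ iterate-* π fixed j ⟩
    x                                  ∎)

orbit : ∀ {m} → (Fin (suc m) → Fin (suc m)) → ℕ → Fin (suc m)
orbit π = iterate π zero

IsFullCycle : ∀ {m} → (Fin (suc m) → Fin (suc m)) → Set
IsFullCycle {m} π = Injective _≡_ _≡_ (orbit π ∘ toℕ {suc m}) × orbit π (suc m) ≡ zero

module FullCycle {m} {π : Fin (suc m) → Fin (suc m)} (full : IsFullCycle π) where

  orbit-surjective : StrictlySurjective _≡_ (orbit π ∘ toℕ)
  orbit-surjective = injective⇒surjective _ (proj₁ full)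

  orbit-≢zero : ∀ {k} → 0 < k → k < suc m → orbit π k ≢ zero
  orbit-≢zero 0<k k<n returned = <⇒≢ 0<k (sym (injective-below (orbit π) (proj₁ full) k<n (s≤s z≤n) returned))

  orbit-complement : ∀ k → k ≤ suc m → iterate π (orbit π k) (suc m ∸ k) ≡ zero
  orbit-complement k k≤n = trans (sym (iterate-+ π zero k (suc m ∸ k))) (trans (cong (orbit π) (m+[n∸m]≡n k≤n)) (proj₂ full))

  surjective : StrictlySurjective _≡_ π
  surjective y with orbit-surjective y
  ... | zero  , refl = orbit π m , trans (sym (iterate-suc π zero m)) (proj₂ full)
  ... | suc i , refl = orbit π (toℕ i) , sym (iterate-suc π zero (toℕ i))

  returns : ∀ x → iterate π x (suc m) ≡ x
  returns x with i , refl ← orbit-surjective x =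
    trans (iterate-comm π zero (toℕ i) (suc m)) (cong (λ y → iterate π y (toℕ i)) (proj₂ full))

  no-early-return : ∀ x {d} → 0 < d → d < suc m → iterate π x d ≢ x
  no-early-return x {d} 0<d d<n fixed with i , refl ← orbit-surjective x =
    orbit-≢zero 0<d d<n (begin
      orbit π d                          ≡⟨ cong (λ y → iterate π y d) (orbit-complement (toℕ i) (<⇒≤ (toℕ<n i))) ⟨
      iterate π (iterate π x r) d        ≡⟨ iterate-comm π x r d ⟩
      iterate π (iterate π x d) r        ≡⟨ cong (λ y → iterate π y r) fixed ⟩
      iterate π x r                      ≡⟨ orbit-complement (toℕ i) (<⇒≤ (toℕ<n i)) ⟩
      zero                               ∎)
    where r = suc m ∸ toℕ i

module _ {m} {π : Fin (suc m) → Fin (suc m)} (π-injective : Injective _≡_ _≡_ π) where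

  covering-orbit⇒fullCycle : (∀ y → ∃ λ k → orbit π k ≡ y) → IsFullCycle π
  covering-orbit⇒fullCycle covers = from-period (period π-injective zero)
    where
    from-period : (∃ λ d → 0 < d × d ≤ suc m × orbit π d ≡ zero) → IsFullCycle π
    from-period (d , 0<d , d≤n , fixed) = orbit-injective , closes
      where
      instance
        d≢0 : NonZero d
        d≢0 = >-nonZero 0<d
      reduce : ∀ k → orbit π (k % d) ≡ orbit π k
      reduce k = sym (begin
        orbit π k                                ≡⟨ cong (orbit π) (m≡m%n+[m/n]*n k d) ⟩
        orbit π (k % d + k / d * d)              ≡⟨ iterate-+ π zero (k % d) (k / d * d) ⟩
        iterate π (orbit π (k % d)) (k / d * d)  ≡⟨ iterate-comm π zero (k % d) (k / d * d) ⟩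
        iterate π (orbit π (k / d * d)) (k % d)  ≡⟨ cong (λ y → iterate π y (k % d)) (iterate-* π fixed (k / d)) ⟩
        orbit π (k % d)                          ∎)
      orbit-surjective : StrictlySurjective _≡_ (orbit π ∘ toℕ {suc m})
      orbit-surjective y with k , refl ← covers y = fromℕ< r<n , trans (cong (orbit π) (toℕ-fromℕ< r<n)) (reduce k)
        where r<n = <-≤-trans (m%n<n k d) d≤n
      orbit-injective : Injective _≡_ _≡_ (orbit π ∘ toℕ {suc m})
      orbit-injective = surjective⇒injective _ orbit-surjective
      closes : orbit π (suc m) ≡ zero
      closes with m≤n⇒m<n∨m≡n d≤n
      ... | inj₂ refl = fixed
      ... | inj₁ d<n = ⊥-elim (<⇒≢ 0<d (sym (injective-below (orbit π) orbit-injective d<n (s≤s z≤n) fixed)))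

  descending⇒covering-orbit : (∀ a → ∃ λ j → toℕ (iterate π (suc a) j) < suc (toℕ a)) →
                              ∀ y → ∃ λ k → orbit π k ≡ y
  descending⇒covering-orbit descends y = reach y (<-wellFounded y)
    where
    reach : ∀ y → Acc Fin._<_ y → ∃ λ k → orbit π k ≡ y
    reach zero    _             = 0 , refl
    reach (suc a) (acc smaller) with j , lower ← descends a
      with k , reached ← reach _ (smaller lower) | i , back ← iterate-returns π-injective (suc a) j =
      k + i , trans (iterate-+ π zero k i) (trans (cong (λ y → iterate π y i) reached) back)

IsFullCycle-resp : ∀ {m} {π π′ : Fin (suc m) → Fin (suc m)} → (∀ x → π x ≡ π′ x) → IsFullCycle π → IsFullCycle π′
IsFullCycle-resp {m} π≗π′ (injective , closes) =
  (λ {x} {y} eq → injective (trans (same (toℕ x)) (trans eq (sym (same (toℕ y)))))) , trans (sym (same (suc m))) closes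
  where same = iterate-cong π≗π′ zero

-- Permutations and their standard cycle form

T-==F : ∀ {n} {a b : Fin n} → T (a ==F b) ⇔ a ≡ b
T-==F {a = a} {b} = mk⇔ (toℕ-injective ∘ ≡ᵇ⇒≡ (toℕ a) (toℕ b)) (≡⇒≡ᵇ (toℕ a) (toℕ b) ∘ cong toℕ)

isPerm⇔surjective : ∀ {n} (v : Vec (Fin n) n) → T (isPerm v) ⇔ StrictlySurjective _≡_ (lookup v)
isPerm⇔surjective {n} v = mk⇔ to from
  where
  to : T (isPerm v) → StrictlySurjective _≡_ (lookup v)
  to perm j = VecAny.index hit , Equivalence.to T-==F (VecAny.lookup-index hit)
    where
    hit : VecAny.Any (λ x → T (x ==F j)) v
    hit = VecAny.toList⁻ (Any.any⁻ _ (toList v) (All.lookup (All.all⁺ _ (allFin n) perm) (∈-allFin j)))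
  from : StrictlySurjective _≡_ (lookup v) → T (isPerm v)
  from surj = All.all⁻ _ {allFin n} (All.tabulate λ {j} _ →
    Any.any⁺ (_==F j) (lose (∈-toList⁺ (∈-lookup (proj₁ (surj j)) v)) (Equivalence.from T-==F (proj₂ (surj j)))))

==F-refl : ∀ {n} (a : Fin n) → (a ==F a) ≡ true
==F-refl a = Equivalence.to T-≡ (Equivalence.from (T-==F {a = a}) refl)

==F-≢ : ∀ {n} {a b : Fin n} → a ≢ b → (a ==F b) ≡ false
==F-≢ {a = a} {b} a≢b with a ==F b in eq
... | true  = ⊥-elim (a≢b (Equivalence.to T-==F (Equivalence.from T-≡ eq)))
... | false = refl

module _ {n} (v : Vec (Fin n) n) where

  ∈-iter⁻ : ∀ k y {x} → x ∈ iter v k y → ∃ λ j → iterate (lookup v) y j ≡ x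
  ∈-iter⁻ (suc k) y (here refl) = 0 , refl
  ∈-iter⁻ (suc k) y (there x∈) with j , reached ← ∈-iter⁻ k (lookup v y) x∈ = suc j , reached

  ∈-cycleFrom⁻ : ∀ a {x} → x ∈ cycleFrom v a → ∃ λ j → iterate (lookup v) a j ≡ x
  ∈-cycleFrom⁻ a (here refl) = 0 , refl
  ∈-cycleFrom⁻ a (there x∈) with j , reached ← ∈-iter⁻ n (lookup v a) (Sublist.lookup (takeWhile-⊆ _ _) x∈) =
    suc j , reached

  ¬cycleMin⇒descends : ∀ a → ¬ T (isCycleMin v a) → ∃ λ j → toℕ (iterate (lookup v) a j) < toℕ a
  ¬cycleMin⇒descends a ¬min
    with x , x∈ , a≰x ← find (¬All⇒Any¬ (λ x → T? (toℕ a ℕ.≤ᵇ toℕ x)) _ (¬min ∘ All.all⁻ _))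
    with j , refl ← ∈-cycleFrom⁻ a x∈ = j , ≰⇒> (a≰x ∘ ≤⇒≤ᵇ)

  takeWhile-iter : ∀ a k y s → s < k → (∀ t → t < s → iterate (lookup v) y t ≢ a) → iterate (lookup v) y s ≡ a →
    takeWhileᵇ (λ x → not (x ==F a)) (iter v k y) ≡ tabulate {n = s} (iterate (lookup v) y ∘ toℕ)
  takeWhile-iter a (suc k) y zero    _         _      refl rewrite ==F-refl y = refl
  takeWhile-iter a (suc k) y (suc s) (s≤s s<k) avoids hits rewrite ==F-≢ (avoids 0 (s≤s z≤n)) =
    cong (y ∷_) (takeWhile-iter a k (lookup v y) s s<k (λ t → avoids (suc t) ∘ s≤s) hits)

RejectsMinimumFirst : Pattern → Set
RejectsMinimumFirst p = ∀ a b → orderIso (0 , suc a , suc b) p ≡ false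

predOr : ∀ {m} → Fin m → Fin (suc m) → Fin m
predOr d zero    = d
predOr d (suc j) = j

suc-predOr : ∀ {m} (d : Fin m) {z : Fin (suc m)} → z ≢ zero → suc (predOr d z) ≡ z
suc-predOr d {zero}  z≢0 = ⊥-elim (z≢0 refl)
suc-predOr d {suc j} _   = refl

-- For a full cycle π^(i+1)(0) ≠ 0, so the fallback value of predOr is never used.
cycleWord : ∀ {m} → Vec (Fin (suc m)) (suc m) → Vec (Fin m) m
cycleWord v = Vec.tabulate λ i → predOr i (orbit (lookup v) (suc (toℕ i)))

toList≡tabulate∘lookup : ∀ {A : Set} {n} (xs : Vec A n) → toList xs ≡ tabulate (lookup xs)
toList≡tabulate∘lookup Vec.[]       = refl
toList≡tabulate∘lookup (x Vec.∷ xs) = cong (x ∷_) (toList≡tabulate∘lookup xs)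

module _ {m} (v : Vec (Fin (suc m)) (suc m)) where

  zero-isCycleMin : T (isCycleMin v zero)
  zero-isCycleMin = All.all⁻ (λ x → 0 ℕ.≤ᵇ toℕ x) {cycleFrom v zero} (All.tabulate λ _ → _)

  numCycles≡1+nonzero : numCycles v ≡ suc (length (filterᵇ (isCycleMin v) (tabulate suc)))
  numCycles≡1+nonzero = trans (length-reverse (filterᵇ (isCycleMin v) (allFin (suc m))))
    (cong length (filter-accept (T? ∘ isCycleMin v) {x = zero} {xs = tabulate suc} zero-isCycleMin))

  numCycles≡1⇒nonzero-¬cycleMin : numCycles v ≡ 1 → ∀ a → ¬ T (isCycleMin v (suc a))
  numCycles≡1⇒nonzero-¬cycleMin one a isMin =
    <⇒≢ (filter-some (T? ∘ isCycleMin v) (lose (∈-tabulate⁺ a) isMin))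
        (sym (ℕ-suc-injective (trans (sym numCycles≡1+nonzero) one)))

  oneCycle⇒fullCycle : T (isPerm v) → numCycles v ≡ 1 → IsFullCycle (lookup v)
  oneCycle⇒fullCycle perm one =
    covering-orbit⇒fullCycle injective (descending⇒covering-orbit injective λ a →
      ¬cycleMin⇒descends v (suc a) (numCycles≡1⇒nonzero-¬cycleMin one a))
    where
    injective : Injective _≡_ _≡_ (lookup v)
    injective = surjective⇒injective _ (Equivalence.to (isPerm⇔surjective v) perm)

  module FullCycleForm (full : IsFullCycle (lookup v)) where
    open FullCycle full

    cycleFrom-full : ∀ a → cycleFrom v a ≡ a ∷ tabulate {n = m} (λ i → iterate (lookup v) a (suc (toℕ i)))
    cycleFrom-full a = cong (a ∷_) (takeWhile-iter v a (suc m) (lookup v a) m (n<1+n m)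
      (λ t t<m → no-early-return a (s≤s z≤n) (s≤s t<m)) (returns a))

    zero∈cycleFrom : ∀ a → zero ∈ cycleFrom v (suc a)
    zero∈cycleFrom a with orbit-surjective (suc a)
    ... | suc k , reached = subst (zero ∈_) (sym (cycleFrom-full (suc a)))
      (there (subst (_∈ _) closes (∈-tabulate⁺ {f = λ i → iterate (lookup v) (suc a) (suc (toℕ i))} (Fin.opposite k))))
      where
      closes : iterate (lookup v) (suc a) (suc (toℕ (Fin.opposite k))) ≡ zero
      closes = begin
        iterate (lookup v) (suc a) (suc (toℕ (Fin.opposite k)))
          ≡⟨ cong₂ (iterate (lookup v)) (sym reached) (cong suc (opposite-prop k)) ⟩
        iterate (lookup v) (orbit (lookup v) (suc (toℕ k))) (suc (m ∸ suc (toℕ k)))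
          ≡⟨ cong (iterate (lookup v) _) (+-∸-assoc 1 (toℕ<n k)) ⟨
        iterate (lookup v) (orbit (lookup v) (suc (toℕ k))) (suc m ∸ suc (toℕ k))
          ≡⟨ orbit-complement (suc (toℕ k)) (s≤s (<⇒≤ (toℕ<n k))) ⟩
        zero ∎

    nonzero-¬cycleMin : ∀ a → ¬ T (isCycleMin v (suc a))
    nonzero-¬cycleMin a isMin = All.lookup (All.all⁺ _ (cycleFrom v (suc a)) isMin) (zero∈cycleFrom a)

    cycleMins-full : cycleMins v ≡ zero ∷ []
    cycleMins-full = cong reverse (begin
      filterᵇ (isCycleMin v) (allFin (suc m))          ≡⟨ filter-accept (T? ∘ isCycleMin v) {x = zero} {xs = tabulate suc} zero-isCycleMin ⟩
      zero ∷ filterᵇ (isCycleMin v) (tabulate suc)     ≡⟨ cong (zero ∷_) (filter-none (T? ∘ isCycleMin v) (All.tabulate⁺ nonzero-¬cycleMin)) ⟩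
      zero ∷ []                                        ∎)

    numCycles-full : numCycles v ≡ 1
    numCycles-full = cong length cycleMins-full

    isPerm-full : T (isPerm v)
    isPerm-full = Equivalence.from (isPerm⇔surjective v) surjective

    suc-cycleWord : ∀ i → suc (lookup (cycleWord v) i) ≡ orbit (lookup v) (suc (toℕ i))
    suc-cycleWord i = trans (cong suc (lookup∘tabulate (λ j → predOr j (orbit (lookup v) (suc (toℕ j)))) i))
                            (suc-predOr i (orbit-≢zero (s≤s z≤n) (s≤s (toℕ<n i))))

    isPerm-cycleWord : T (isPerm (cycleWord v))
    isPerm-cycleWord = Equivalence.from (isPerm⇔surjective (cycleWord v)) λ j → letter j (orbit-surjective (suc j))
      where
      letter : ∀ j → (∃ λ k → orbit (lookup v) (toℕ k) ≡ suc j) → ∃ λ i → lookup (cycleWord v) i ≡ j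
      letter j (suc i , reached) = i , suc-injective (trans (suc-cycleWord i) reached)

    psiLabelled-full : psiLabelled v ≡ (0 , 0) ∷ map (λ y → (suc y , 0)) (map toℕ (toList (cycleWord v)))
    psiLabelled-full = begin
      psiLabelled v
        ≡⟨ cong (List.concatMap (λ a → map (λ x → (toℕ x , toℕ a)) (cycleFrom v a))) cycleMins-full ⟩
      map label (cycleFrom v zero) List.++ []
        ≡⟨ ++-identityʳ _ ⟩
      map label (cycleFrom v zero)
        ≡⟨ cong (map label) (cycleFrom-full zero) ⟩
      (0 , 0) ∷ map label (tabulate (λ i → orbit (lookup v) (suc (toℕ i))))
        ≡⟨ cong ((0 , 0) ∷_) (map-tabulate _ label) ⟩
      (0 , 0) ∷ tabulate (λ i → label (orbit (lookup v) (suc (toℕ i))))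
        ≡⟨ cong ((0 , 0) ∷_) (tabulate-cong (cong label ∘ sym ∘ suc-cycleWord)) ⟩
      (0 , 0) ∷ tabulate (λ i → (suc (toℕ (lookup (cycleWord v) i)) , 0))
        ≡⟨ cong ((0 , 0) ∷_) (trans (cong (map _) (map-tabulate (lookup (cycleWord v)) toℕ)) (map-tabulate _ _)) ⟨
      (0 , 0) ∷ map (λ y → (suc y , 0)) (map toℕ (tabulate (lookup (cycleWord v))))
        ≡⟨ cong (λ ws → (0 , 0) ∷ map (λ y → (suc y , 0)) (map toℕ ws)) (toList≡tabulate∘lookup (cycleWord v)) ⟨
      (0 , 0) ∷ map (λ y → (suc y , 0)) (map toℕ (toList (cycleWord v)))
        ∎
      where
      label : Fin (suc m) → ℕ × ℕ
      label x = toℕ x , 0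

    cycOcc-full : ∀ p → RejectsMinimumFirst p → cycOcc p v ≡ lineOcc p (cycleWord v)
    cycOcc-full p minimum-first =
      trans (cong (countᵇ _ ∘ windows3) psiLabelled-full)
            (countᵇ-windows3-∷-map (λ _ _ _ → refl) minimum-first (map toℕ (toList (cycleWord v))))

-- Lowering a full cycle to a word is a bijection

cycleWord-injective : ∀ {m} {v v′ : Vec (Fin (suc m)) (suc m)} → IsFullCycle (lookup v) → IsFullCycle (lookup v′) →
  cycleWord v ≡ cycleWord v′ → v ≡ v′
cycleWord-injective {m} {v} {v′} full full′ same =
  trans (sym (tabulate∘lookup v)) (trans (Vec.tabulate-cong successors-agree) (tabulate∘lookup v′))
  where
  π = lookup v
  π′ = lookup v′
  orbits-agree : ∀ {k} → k ≤ suc m → orbit π k ≡ orbit π′ k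
  orbits-agree {zero}  _   = refl
  orbits-agree {suc t} t<n with m≤n⇒m<n∨m≡n (s≤s⁻¹ t<n)
  ... | inj₂ refl = trans (proj₂ full) (sym (proj₂ full′))
  ... | inj₁ t<m = begin
    orbit π (suc t)                ≡⟨ cong (orbit π ∘ suc) (toℕ-fromℕ< t<m) ⟨
    orbit π (suc (toℕ i))          ≡⟨ FullCycleForm.suc-cycleWord v full i ⟨
    suc (lookup (cycleWord v) i)   ≡⟨ cong (λ w → suc (lookup w i)) same ⟩
    suc (lookup (cycleWord v′) i)  ≡⟨ FullCycleForm.suc-cycleWord v′ full′ i ⟩
    orbit π′ (suc (toℕ i))         ≡⟨ cong (orbit π′ ∘ suc) (toℕ-fromℕ< t<m) ⟩
    orbit π′ (suc t)               ∎
    where i = fromℕ< t<m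
  successors-agree : ∀ x → π x ≡ π′ x
  successors-agree x with k , refl ← FullCycle.orbit-surjective full x = begin
    π (orbit π (toℕ k))         ≡⟨ iterate-suc π zero (toℕ k) ⟨
    orbit π (suc (toℕ k))       ≡⟨ orbits-agree (toℕ<n k) ⟩
    orbit π′ (suc (toℕ k))      ≡⟨ iterate-suc π′ zero (toℕ k) ⟩
    π′ (orbit π′ (toℕ k))       ≡⟨ cong π′ (orbits-agree (<⇒≤ (toℕ<n k))) ⟨
    π′ (orbit π (toℕ k))        ∎

raisedLetter : ∀ {m k} → Vec (Fin m) k → ℕ → Fin (suc m)
raisedLetter Vec.[]       _       = zero
raisedLetter (x Vec.∷ xs) zero    = suc x
raisedLetter (x Vec.∷ xs) (suc t) = raisedLetter xs t

raisedLetter-< : ∀ {m k} (w : Vec (Fin m) k) {t} (t<k : t < k) → raisedLetter w t ≡ suc (lookup w (fromℕ< t<k))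
raisedLetter-< (x Vec.∷ w) {zero}  _         = refl
raisedLetter-< (x Vec.∷ w) {suc t} (s≤s t<k) = raisedLetter-< w t<k

raisedLetter-≥ : ∀ {m k} (w : Vec (Fin m) k) {t} → k ≤ t → raisedLetter w t ≡ zero
raisedLetter-≥ Vec.[]      _         = refl
raisedLetter-≥ (x Vec.∷ w) (s≤s k≤t) = raisedLetter-≥ w k≤t

-- w is read as the cycle (0 (w₀+1) … (w_{m-1}+1)): the successor of j+1 is the letter after the position of j in w.
cycleOfWord : ∀ {m} (w : Vec (Fin m) m) → (Fin m → Fin m) → Fin (suc m) → Fin (suc m)
cycleOfWord w position zero    = raisedLetter w 0
cycleOfWord w position (suc j) = raisedLetter w (suc (toℕ (position j)))

cycleWord-surjective : ∀ {m} (w : Vec (Fin m) m) → T (isPerm w) →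
  ∃ λ v → IsFullCycle (lookup v) × cycleWord v ≡ w
cycleWord-surjective {m} w perm =
  v , IsFullCycle-resp (sym ∘ lookup∘tabulate π) full ,
  trans (Vec.tabulate-cong λ i → cong (predOr i) (trans (orbit-resp (suc (toℕ i))) (orbit-letter i)))
        (tabulate∘lookup w)
  where
  surj = Equivalence.to (isPerm⇔surjective w) perm
  position : Fin m → Fin m
  position = proj₁ ∘ surj
  position-lookup : ∀ i → position (lookup w i) ≡ i
  position-lookup i = surjective⇒injective _ surj (proj₂ (surj (lookup w i)))
  π = cycleOfWord w position
  v = Vec.tabulate π
  orbit-resp : ∀ k → orbit (lookup v) k ≡ orbit π k
  orbit-resp = iterate-cong (lookup∘tabulate π) zero
  orbit-raised : ∀ t → t ≤ m → orbit π (suc t) ≡ raisedLetter w t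
  orbit-raised zero    _   = refl
  orbit-raised (suc t) t<m = begin
    orbit π (suc (suc t))                                          ≡⟨ iterate-suc π zero (suc t) ⟩
    π (orbit π (suc t))                                            ≡⟨ cong π (orbit-raised t (<⇒≤ t<m)) ⟩
    π (raisedLetter w t)                                           ≡⟨ cong π (raisedLetter-< w t<m) ⟩
    raisedLetter w (suc (toℕ (position (lookup w (fromℕ< t<m)))))  ≡⟨ cong (raisedLetter w ∘ suc ∘ toℕ) (position-lookup _) ⟩
    raisedLetter w (suc (toℕ (fromℕ< t<m)))                        ≡⟨ cong (raisedLetter w ∘ suc) (toℕ-fromℕ< t<m) ⟩
    raisedLetter w (suc t)                                         ∎
  orbit-letter : ∀ i → orbit π (suc (toℕ i)) ≡ suc (lookup w i)
  orbit-letter i = trans (orbit-raised (toℕ i) (<⇒≤ (toℕ<n i)))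
                         (trans (raisedLetter-< w (toℕ<n i)) (cong (suc ∘ lookup w) (fromℕ<-toℕ i (toℕ<n i))))
  injective : Injective _≡_ _≡_ (orbit π ∘ toℕ {suc m})
  injective {zero}  {zero}  _  = refl
  injective {zero}  {suc j} eq = ⊥-elim (0≢1+n (trans eq (orbit-letter j)))
  injective {suc i} {zero}  eq = ⊥-elim (0≢1+n (trans (sym eq) (orbit-letter i)))
  injective {suc i} {suc j} eq = cong suc (surjective⇒injective _ surj
    (suc-injective (trans (sym (orbit-letter i)) (trans eq (orbit-letter j)))))
  full : IsFullCycle π
  full = injective , trans (orbit-raised m ≤-refl) (raisedLetter-≥ w ≤-refl)

counted⇔fullCycle : ∀ {m} p k (v : Vec (Fin (suc m)) (suc m)) → RejectsMinimumFirst p →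
  T (isPerm v ∧ ((numCycles v ≡ᵇ 1) ∧ (cycOcc p v ≡ᵇ k))) ⇔ (IsFullCycle (lookup v) × T (lineOcc p (cycleWord v) ≡ᵇ k))
counted⇔fullCycle p k v minimum-first = mk⇔ to from
  where
  to : T (isPerm v ∧ ((numCycles v ≡ᵇ 1) ∧ (cycOcc p v ≡ᵇ k))) → IsFullCycle (lookup v) × T (lineOcc p (cycleWord v) ≡ᵇ k)
  to counted =
    let perm , rest = Equivalence.to T-∧ counted
        one , occ = Equivalence.to (T-∧ {numCycles v ≡ᵇ 1}) rest
        full = oneCycle⇒fullCycle v perm (≡ᵇ⇒≡ _ _ one)
    in full , subst (λ c → T (c ≡ᵇ k)) (FullCycleForm.cycOcc-full v full p minimum-first) occ
  from : IsFullCycle (lookup v) × T (lineOcc p (cycleWord v) ≡ᵇ k) → T (isPerm v ∧ ((numCycles v ≡ᵇ 1) ∧ (cycOcc p v ≡ᵇ k)))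
  from (full , occ) = Equivalence.from T-∧ (isPerm-full , Equivalence.from T-∧
    (≡⇒≡ᵇ _ _ numCycles-full , subst (λ c → T (c ≡ᵇ k)) (sym (cycOcc-full p minimum-first)) occ))
    where open FullCycleForm v full

minimum-first-rejected : (p : Pattern) → p ≡ (2 , 1 , 3) ⊎ p ≡ (2 , 3 , 1) ⊎ p ≡ (3 , 1 , 2) → RejectsMinimumFirst p
minimum-first-rejected _ (inj₁ refl)        a b = refl
minimum-first-rejected _ (inj₂ (inj₁ refl)) a b = refl
minimum-first-rejected _ (inj₂ (inj₂ refl)) a b = refl

mainTheorem5 : (p : Pattern) → p ≡ (2 , 1 , 3) ⊎ p ≡ (2 , 3 , 1) ⊎ p ≡ (3 , 1 , 2) →
    (k n : ℕ) → 1 ≤ n → f p k 1 n ≡ g p k (n ∸ 1)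
mainTheorem5 p hp k (suc m) _ =
  countᵇ-bijection (allVecs-unique _ _) (allVecs-unique _ _) (∈-allVecs _ _) (∈-allVecs _ _)
    counted listed cycleWord preserved injective surjective
  where
  counted : Vec (Fin (suc m)) (suc m) → Bool
  counted v = isPerm v ∧ ((numCycles v ≡ᵇ 1) ∧ (cycOcc p v ≡ᵇ k))
  listed : Vec (Fin m) m → Bool
  listed w = isPerm w ∧ (lineOcc p w ≡ᵇ k)
  characterised : ∀ v → T (counted v) → IsFullCycle (lookup v) × T (lineOcc p (cycleWord v) ≡ᵇ k)
  characterised v = Equivalence.to (counted⇔fullCycle p k v (minimum-first-rejected p hp))
  preserved : ∀ v → T (counted v) → T (listed (cycleWord v))
  preserved v c = Equivalence.from T-∧
    (FullCycleForm.isPerm-cycleWord v (proj₁ (characterised v c)) , proj₂ (characterised v c))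
  injective : ∀ v v′ → T (counted v) → T (counted v′) → cycleWord v ≡ cycleWord v′ → v ≡ v′
  injective v v′ c c′ = cycleWord-injective (proj₁ (characterised v c)) (proj₁ (characterised v′ c′))
  surjective : ∀ w → T (listed w) → ∃ λ v → T (counted v) × cycleWord v ≡ w
  surjective w c = lift (cycleWord-surjective w (proj₁ (Equivalence.to T-∧ c)))
    where
    lift : (∃ λ v → IsFullCycle (lookup v) × cycleWord v ≡ w) → ∃ λ v → T (counted v) × cycleWord v ≡ w
    lift (v , full , same) =
      v , Equivalence.from (counted⇔fullCycle p k v (minimum-first-rejected p hp))
            (full , subst (λ u → T (lineOcc p u ≡ᵇ k)) (sym same) (proj₂ (Equivalence.to T-∧ c))) , same
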